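{- Let $w$ be a double occurrence word in ascending order of length $n$, $\nu\ge1$, and let $\mathcal I_1(\nu,k_1,\ell_1)$, $\mathcal I_2(\nu,k_2,\ell_2)$ be insertions into $w$ with $w\star\mathcal I_1(\nu,k_1,\ell_1)\sim w\star\mathcal I_2(\nu,k_2,\ell_2)$, $k_1=1$, $\ell_2=n+1$ and $k_1<k_2\le\ell_1<\ell_2$. Write $w=z_1z_2z_3$ with $|z_1|=k_2-1$ and $|z_1z_2|=\ell_1-1$. Then $z_1,z_3$ are single occurrence words, and (1) if $\mathcal I_1,\mathcal I_2$ are both repeat insertions, then $z_1z_3$ is a repeat word in $w$; (2) if $\mathcal I_1,\mathcal I_2$ are both return insertions, then $h=(k_2-k_1)/\nu$ is a positive integer and $z_1z_3\sim\mathrm{Int}(h,\nu)$.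
   Context: Alphabet $\Sigma=\mathbb{N}$; words are finite sequences over $\Sigma$, $|w|$ is length, $w^R$ the reverse. A double occurrence word (DOW) is a word in which every symbol occurs zero or exactly two times; a single occurrence word (SOW) is a nonempty word with pairwise distinct symbols. An equivalence map is a morphism of $\Sigma^*$ induced by a bijection $\Sigma\to\Sigma$; $x\sim y$ means $f(x)=y$ for some equivalence map $f$. A word is in ascending order if it is empty or its first symbol is $1$ and the first occurrence of each symbol is one greater than the largest symbol preceding it. For a SOW $v$, $vv$ is a repeat word in $w$ if $w=avbvc$ for words $a,b,c$. Insertions: for a DOW $w$ in ascending order with largest symbol $M$, $\nu\ge1$, $u=(M+1)\cdots(M+\nu)$ and $1\le k\le\ell\le|w|+1$, write $w=y_1y_2y_3$ with $|y_1|=k-1$, $|y_1y_2|=\ell-1$; the repeat insertion gives $w\star\rho(\nu,k,\ell)=y_1uy_2uy_3$ and the return insertion gives $w\star\tau(\nu,k,\ell)=y_1uy_2u^Ry_3$; $\mathcal I(\nu,k,\ell)$ denotes either. For $h,\nu\ge1$ let $x_i=((i-1)\nu+1)\cdots(i\nu)$, $1\le i\le h$; $\mathrm{Int}(h,\nu)=x_1\cdots x_hx_1^R\cdots x_h^R$. -}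

module Defs where

open import Data.Nat using (ℕ; zero; suc; _+_; _*_; _∸_; _⊔_)
open import Data.Nat.Properties using (_≟_)
open import Data.List using (List; []; _∷_; _++_; length; take; drop; reverse; map; applyUpTo; concat; foldr)
open import Data.List.Membership.Propositional using (_∉_)
open import Data.List.Relation.Unary.Unique.Propositional using (Unique)
open import Data.Product using (Σ; ∃; _×_; _,_)
open import Data.Sum using (_⊎_)
open import Relation.Binary.PropositionalEquality using (_≡_; _≢_)
open import Relation.Nullary using (yes; no)
open import Function.Bundles using (_↔_; Inverse)

Word : Set
Word = List ℕ

occ : ℕ → Word → ℕ
occ x [] = 0
occ x (y ∷ w) with x ≟ y
... | yes _ = suc (occ x w)
... | no  _ = occ x w

DOW : Word → Set
DOW w = ∀ (x : ℕ) → occ x w ≡ 0 ⊎ occ x w ≡ 2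

SOW : Word → Set
SOW w = w ≢ [] × Unique w

maxSym : Word → ℕ
maxSym = foldr _⊔_ 0

-- ascending order: the first occurrence of each symbol is one greater than the
-- largest symbol preceding it (with max of the empty prefix = 0, so the first
-- symbol of a nonempty word is 1)
Ascending : Word → Set
Ascending w = ∀ (a c : Word) (x : ℕ) → w ≡ a ++ (x ∷ c) → x ∉ a → x ≡ suc (maxSym a)

_∼_ : Word → Word → Set
x ∼ y = Σ (ℕ ↔ ℕ) (λ f → map (Inverse.to f) x ≡ y)

newBlock : ℕ → ℕ → Word
newBlock M ν = applyUpTo (λ j → suc (M + j)) ν

data InsType : Set where
  repeatIns returnIns : InsType

insert : InsType → Word → ℕ → ℕ → ℕ → Word
insert t w ν k ℓ = y1 ++ u ++ y2 ++ u' t ++ y3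
  where
  u  = newBlock (maxSym w) ν
  y1 = take (k ∸ 1) w
  y2 = drop (k ∸ 1) (take (ℓ ∸ 1) w)
  y3 = drop (ℓ ∸ 1) w
  u' : InsType → Word
  u' repeatIns = u
  u' returnIns = reverse u

RepeatWordIn : Word → Word → Set
RepeatWordIn vv w = Σ Word (λ v → SOW v × vv ≡ v ++ v ×
  Σ Word (λ a → Σ Word (λ b → Σ Word (λ c → w ≡ a ++ v ++ b ++ v ++ c))))

-- x_{i+1} = (iν+1) ... ((i+1)ν)
xBlock : ℕ → ℕ → Word
xBlock ν i = applyUpTo (λ j → suc (i * ν + j)) ν

Int : ℕ → ℕ → Word
Int h ν = concat (applyUpTo (xBlock ν) h) ++ concat (applyUpTo (λ i → reverse (xBlock ν i)) h)

-- Let u be the inserted block and F the bijection. As the first insertion starts the word and the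
-- second one ends it, F maps u z₁ z₂ u₁ z₃ to z₁ u z₂ z₃ u₂, and comparing lengths splits this into the
-- shift equations F(u z₁) = z₁ u and F(u₁ z₃) = z₃ u₂. A shift equation F(v y) = y x forces y to be
-- F v, F² v, … read block by block, the last block possibly cut short; as u is fresh and has
-- distinct symbols, z₁ and z₃ have distinct symbols too. For two repeat insertions z₁ and z₃ solve the
-- same shift equation and do not meet u, so z₁ = z₃. For two return insertions the blocks of z₃ are
-- those of z₁ reversed, and no block can be cut short; so z₁ = b₁ ⋯ b_h and z₃ = b₁ᴿ ⋯ b_hᴿ with
-- |bᵢ| = ν, and any bijection taking z₁ to 1 2 ⋯ hν takes z₁ z₃ to Int(h, ν).

module Submission where

open import Defs
open import Data.Nat using (ℕ; zero; suc; _+_; _*_; _∸_; _⊓_; _≤_; _<_; z≤n; s≤s)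
open import Data.Nat.Properties
  using (_≟_; ≤-trans; ≤-refl; m≤m+n; m≤n⇒m⊓n≡m; m≤m⊔n; m≤n⊔m; +-comm; +-cancelˡ-≡; suc-injective;
         <⇒≢; <⇒≤; n≮n; ∸-monoˡ-≤; ∸-monoˡ-<; m<n⇒0<n∸m)
open import Data.Nat.Induction using (<-wellFounded)
open import Induction.WellFounded using (Acc; acc)
open import Data.List
  using (List; []; _∷_; _++_; _∷ʳ_; [_]; length; take; drop; reverse; map; applyUpTo; concat)
open import Data.List.Properties
  using (∷-injective; ++-assoc; ++-identityʳ; ++-conicalʳ; ∷ʳ-++; map-++; map-∘; map-cong; map-id-local;
         length-map; length-++; length-++-≤ʳ; length-++-comm; length-take; length-drop; length-applyUpTo;
         take-take; take-all; reverse-++; reverse-injective; drop-all; take++drop≡id; reverse-map; concat-map; concat-++;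
         applyUpTo-∷ʳ; map-applyUpTo)
open import Data.List.Membership.Propositional using (_∈_)
open import Data.List.Membership.Propositional.Properties using (∈-map⁻; ∈-++⁺ˡ; ∈-++⁺ʳ; ∈-applyUpTo⁻)
open import Data.List.Relation.Unary.Any using (here; there)
import Data.List.Relation.Unary.Any.Properties as Any
open import Data.List.Relation.Unary.All using (All; []; _∷_)
import Data.List.Relation.Unary.All as All
import Data.List.Relation.Unary.All.Properties as All
open import Data.List.Relation.Unary.AllPairs using (_∷_)
open import Data.List.Relation.Unary.Unique.Propositional using (Unique)
import Data.List.Relation.Unary.Unique.Propositional.Properties as Unique
open import Data.List.Relation.Binary.Disjoint.Propositional using (Disjoint)
open import Relation.Binary.PropositionalEquality hiding ([_])
open import Data.List.Relation.Binary.Permutation.Setoid (setoid ℕ) using (_↭_; ↭-refl; ↭-sym)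
open import Data.List.Relation.Binary.Permutation.Setoid.Properties (setoid ℕ)
  using (↭-reverse; Unique-resp-↭; ∈-resp-↭; xs↭ys⇒|xs|≡|ys|)
open import Data.Product using (Σ; ∃-syntax; _×_; _,_; proj₁; proj₂)
open import Data.Sum using (_⊎_; inj₁; inj₂)
open import Data.Empty using (⊥-elim)
open import Relation.Nullary using (Dec; yes; no)
open import Function.Bundles using (_↔_; Inverse; mk↔ₛ′)
open import Function.Construct.Composition using (_↔-∘_)
open import Function.Construct.Identity using (↔-id)
open import Function.Base using (_∘_)

++-split : ∀ (ws xs ys zs : Word) → ws ++ xs ≡ ys ++ zs →
           (∃[ e ] ys ≡ ws ++ e × xs ≡ e ++ zs) ⊎ (∃[ e ] e ≢ [] × ws ≡ ys ++ e × zs ≡ e ++ xs)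
++-split []       xs ys       zs eq = inj₁ (ys , refl , eq)
++-split (w ∷ ws) xs []       zs eq = inj₂ (w ∷ ws , (λ ()) , refl , sym eq)
++-split (w ∷ ws) xs (y ∷ ys) zs eq with refl , eq′ ← ∷-injective eq with ++-split ws xs ys zs eq′
... | inj₁ (e , ys≡ , xs≡)        = inj₁ (e , cong (w ∷_) ys≡ , xs≡)
... | inj₂ (e , e≢[] , ws≡ , zs≡) = inj₂ (e , e≢[] , cong (w ∷_) ws≡ , zs≡)

++-cancel-length : ∀ (ws xs ys zs : Word) → length ws ≡ length ys → ws ++ xs ≡ ys ++ zs →
                   ws ≡ ys × xs ≡ zs
++-cancel-length []       xs []       zs _   eq = refl , eq
++-cancel-length (w ∷ ws) xs (y ∷ ys) zs len eq with refl , eq′ ← ∷-injective eq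
  with ws≡ys , xs≡zs ← ++-cancel-length ws xs ys zs (suc-injective len) eq′ = cong (w ∷_) ws≡ys , xs≡zs

nonempty-∈ : ∀ {xs : Word} → xs ≢ [] → ∃[ x ] x ∈ xs
nonempty-∈ {[]}    xs≢[] = ⊥-elim (xs≢[] refl)
nonempty-∈ {x ∷ _} _     = x , here refl

length-++-<ʳ : ∀ {xs : Word} ys → xs ≢ [] → length ys < length (xs ++ ys)
length-++-<ʳ {[]}     ys xs≢[] = ⊥-elim (xs≢[] refl)
length-++-<ʳ {x ∷ xs} ys _     = s≤s (length-++-≤ʳ ys {xs})

map-≢[] : ∀ (f : ℕ → ℕ) {xs} → xs ≢ [] → map f xs ≢ []
map-≢[] f {[]}    xs≢[] _  = xs≢[] refl
map-≢[] f {_ ∷ _} _     ()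

∷ʳ-≢[] : ∀ (xs : Word) {x} → xs ∷ʳ x ≢ []
∷ʳ-≢[] xs {x} eq with () ← ++-conicalʳ xs [ x ] eq

head-∈-++ : ∀ {xs ys zs : Word} {z} → xs ≢ [] → xs ++ ys ≡ z ∷ zs → z ∈ xs
head-∈-++ {[]}    xs≢[] _  = ⊥-elim (xs≢[] refl)
head-∈-++ {_ ∷ _} _     eq with refl , _ ← ∷-injective eq = here refl

reverse-≢[] : ∀ (xs : Word) → xs ≢ [] → reverse xs ≢ []
reverse-≢[] xs xs≢[] eq = xs≢[] (reverse-injective eq)

Unique-++⁻ˡ : ∀ (xs : Word) {ys} → Unique (xs ++ ys) → Unique xs
Unique-++⁻ˡ []       _              = Unique.[]
Unique-++⁻ˡ (x ∷ xs) (x∉ ∷ unique) = All.++⁻ˡ xs x∉ ∷ Unique-++⁻ˡ xs unique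

take≡take++drop-take : ∀ {a b} (w : Word) → a ≤ b → take b w ≡ take a w ++ drop a (take b w)
take≡take++drop-take {a} {b} w a≤b = begin
  take b w                                ≡⟨ take++drop≡id a (take b w) ⟨
  take a (take b w) ++ drop a (take b w)  ≡⟨ cong (_++ drop a (take b w)) (take-take a b w) ⟩
  take (a ⊓ b) w ++ drop a (take b w)     ≡⟨ cong (λ m → take m w ++ drop a (take b w)) (m≤n⇒m⊓n≡m a≤b) ⟩
  take a w ++ drop a (take b w)           ∎
  where open ≡-Reasoning

drop≡drop-take++drop : ∀ {a b} (w : Word) → a ≤ b → drop a w ≡ drop a (take b w) ++ drop b w
drop≡drop-take++drop {zero}  {b}     w       _         = sym (take++drop≡id b w)
drop≡drop-take++drop {suc a} {suc b} []      _         = refl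
drop≡drop-take++drop {suc a} {suc b} (_ ∷ w) (s≤s a≤b) = drop≡drop-take++drop w a≤b

∈⇒≤maxSym : ∀ {x} (w : Word) → x ∈ w → x ≤ maxSym w
∈⇒≤maxSym (y ∷ w) (here refl) = m≤m⊔n y (maxSym w)
∈⇒≤maxSym (y ∷ w) (there x∈w) = ≤-trans (∈⇒≤maxSym w x∈w) (m≤n⊔m y (maxSym w))

newBlock-unique : ∀ M ν → Unique (newBlock M ν)
newBlock-unique M ν = Unique.applyUpTo⁺₁ _ ν λ i<j _ eq → <⇒≢ i<j (+-cancelˡ-≡ M _ _ (suc-injective eq))

newBlock-fresh : ∀ (w : Word) ν → Disjoint (newBlock (maxSym w) ν) w
newBlock-fresh w ν (x∈u , x∈w) with ∈-applyUpTo⁻ _ x∈u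
... | i , _ , refl = n≮n (maxSym w) (≤-trans (s≤s (m≤m+n (maxSym w) i)) (∈⇒≤maxSym w x∈w))

closingBlock : InsType → Word → Word
closingBlock repeatIns u = u
closingBlock returnIns u = reverse u

closingBlock-↭ : ∀ t (u : Word) → closingBlock t u ↭ u
closingBlock-↭ repeatIns u = ↭-refl
closingBlock-↭ returnIns u = ↭-reverse u

insert-closingBlock : ∀ t w ν k ℓ → let u = newBlock (maxSym w) ν in
  insert t w ν k ℓ ≡ take (k ∸ 1) w ++ u ++ drop (k ∸ 1) (take (ℓ ∸ 1) w) ++ closingBlock t u ++ drop (ℓ ∸ 1) w
insert-closingBlock repeatIns w ν k ℓ = refl
insert-closingBlock returnIns w ν k ℓ = refl

insertion-equations : ∀ (F : ℕ → ℕ) (u z₁ z₂ z₃ u₁ u₂ : Word) →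
  map F (u ++ (z₁ ++ z₂) ++ u₁ ++ z₃) ≡ z₁ ++ u ++ (z₂ ++ z₃) ++ u₂ →
  map F (u ++ z₁) ≡ z₁ ++ u × map F (u₁ ++ z₃) ≡ z₃ ++ u₂
insertion-equations F u z₁ z₂ z₃ u₁ u₂ eq =
  proj₁ split₁ , proj₂ (++-cancel-length (map F z₂) _ z₂ _ (length-map F z₂) (proj₂ split₁))
  where
  open ≡-Reasoning
  eq′ : map F (u ++ z₁) ++ map F z₂ ++ map F (u₁ ++ z₃) ≡ (z₁ ++ u) ++ z₂ ++ z₃ ++ u₂
  eq′ = begin
    map F (u ++ z₁) ++ map F z₂ ++ map F (u₁ ++ z₃) ≡⟨ cong (map F (u ++ z₁) ++_) (map-++ F z₂ (u₁ ++ z₃)) ⟨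
    map F (u ++ z₁) ++ map F (z₂ ++ u₁ ++ z₃)       ≡⟨ map-++ F (u ++ z₁) _ ⟨
    map F ((u ++ z₁) ++ z₂ ++ u₁ ++ z₃)             ≡⟨ cong (map F) (++-assoc u z₁ _) ⟩
    map F (u ++ z₁ ++ z₂ ++ u₁ ++ z₃)               ≡⟨ cong (λ s → map F (u ++ s)) (++-assoc z₁ z₂ _) ⟨
    map F (u ++ (z₁ ++ z₂) ++ u₁ ++ z₃)             ≡⟨ eq ⟩
    z₁ ++ u ++ (z₂ ++ z₃) ++ u₂                     ≡⟨ cong (λ s → z₁ ++ u ++ s) (++-assoc z₂ z₃ u₂) ⟩
    z₁ ++ u ++ z₂ ++ z₃ ++ u₂                       ≡⟨ ++-assoc z₁ u _ ⟨
    (z₁ ++ u) ++ z₂ ++ z₃ ++ u₂                     ∎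
  split₁ : map F (u ++ z₁) ≡ z₁ ++ u × map F z₂ ++ map F (u₁ ++ z₃) ≡ z₂ ++ z₃ ++ u₂
  split₁ = ++-cancel-length (map F (u ++ z₁)) _ (z₁ ++ u) _ (trans (length-map F (u ++ z₁)) (length-++-comm u z₁)) eq′

-- Shift equations  F(v y) = y x

-- Both last blocks in shift-reverse-blocks cut short, leaving the nonempty remainder d of a block and
-- d′ of its reverse.
partial-blocks-empty : ∀ {u y y′ d d′ : Word} → d ≢ [] → (∀ {z} → z ∈ d → z ∈ u) → (∀ {z} → z ∈ d′ → z ∈ u) →
  Disjoint u y → Disjoint u y′ → reverse d ++ reverse y ≡ y′ ++ d′ → y ≡ [] × y′ ≡ []
partial-blocks-empty {y = []}    {[]}     _    _   _    _   _    _  = refl , refl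
partial-blocks-empty {y = c ∷ y} {[]} {d} _ _ d′⊆u u#y _ eq =
  ⊥-elim (u#y (d′⊆u (subst (_ ∈_) eq (∈-++⁺ʳ (reverse d) (Any.reverse⁺ {xs = c ∷ y} (here refl)))) , here refl))
partial-blocks-empty {y′ = c ∷ y′} {d} d≢[] d⊆u _   _   u#y′ eq =
  ⊥-elim (u#y′ (d⊆u (Any.reverse⁻ (head-∈-++ (reverse-≢[] d d≢[]) eq)) , here refl))

module _ {F : ℕ → ℕ} where

  shift-step : ∀ v y {x} → map F (v ++ y) ≡ y ++ x →
    (∃[ y₀ ] y ≡ map F v ++ y₀ × map F (map F v ++ y₀) ≡ y₀ ++ x)
    ⊎ (∃[ d ] d ≢ [] × map F v ≡ y ++ d × x ≡ d ++ map F y)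
  shift-step v y {x} eq with ++-split (map F v) (map F y) y x (trans (sym (map-++ F v y)) eq)
  ... | inj₁ (y₀ , y≡ , Fy≡) = inj₁ (y₀ , y≡ , trans (cong (map F) (sym y≡)) Fy≡)
  ... | inj₂ partial        = inj₂ partial

  shift⇒Unique : (∀ {a b} → F a ≡ F b → a ≡ b) → ∀ {v y x} → v ≢ [] → Unique v → Disjoint v y →
                 map F (v ++ y) ≡ y ++ x → Unique y
  shift⇒Unique F-injective {y = y} = go (<-wellFounded (length y))
    where
    go : ∀ {v y x} → Acc _<_ (length y) → v ≢ [] → Unique v → Disjoint v y →
         map F (v ++ y) ≡ y ++ x → Unique y
    go {v} {y} (acc rec) v≢[] v-unique v#y eq with shift-step v y eq
    ... | inj₂ (_ , _ , Fv≡y++d , _) = Unique-++⁻ˡ _ (subst Unique Fv≡y++d (Unique.map⁺ F-injective v-unique))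
    ... | inj₁ (y₀ , refl , eq₀) =
      Unique.++⁺ Fv-unique (go (rec (length-++-<ʳ y₀ Fv≢[])) Fv≢[] Fv-unique Fv#y₀ eq₀) Fv#y₀
      where
      Fv≢[] : map F v ≢ []
      Fv≢[] = map-≢[] F v≢[]
      Fv-unique : Unique (map F v)
      Fv-unique = Unique.map⁺ F-injective v-unique
      Fv#y₀ : Disjoint (map F v) y₀
      Fv#y₀ (x∈Fv , x∈y₀) with ∈-map⁻ F x∈Fv | ∈-map⁻ F (subst (_ ∈_) (sym eq₀) (∈-++⁺ˡ x∈y₀))
      ... | a , a∈v , refl | b , b∈y , Fa≡Fb = v#y (a∈v , subst (_∈ _) (sym (F-injective Fa≡Fb)) b∈y)

  -- y and y′ are both read off the F-orbit of v symbol by symbol; the first symbol of x cannot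
  -- occur in the longer one.
  shift-determined : ∀ {x} v {y y′} → v ≢ [] → Disjoint x y → Disjoint x y′ →
                     map F (v ++ y) ≡ y ++ x → map F (v ++ y′) ≡ y′ ++ x → y ≡ y′
  shift-determined []      v≢[] _ _ _ _ = ⊥-elim (v≢[] refl)
  shift-determined (a ∷ v) {[]}     {[]}      _ _    _     _  _  = refl
  shift-determined (a ∷ v) {[]}     {c ∷ y′}  _ _    x#y′ eq eq′ with refl , _ ← ∷-injective eq′ =
    ⊥-elim (x#y′ (subst (_ ∈_) eq (here refl) , here refl))
  shift-determined (a ∷ v) {c ∷ y}  {[]}      _ x#y  _    eq eq′ with refl , _ ← ∷-injective eq =
    ⊥-elim (x#y (subst (_ ∈_) eq′ (here refl) , here refl))
  shift-determined (a ∷ v) {c ∷ y}  {c′ ∷ y′} _ x#y  x#y′ eq eq′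
    with refl , eq₀ ← ∷-injective eq | refl , eq₀′ ← ∷-injective eq′ =
    cong (c ∷_) (shift-determined (v ∷ʳ c) (∷ʳ-≢[] v) (λ (p , q) → x#y (p , there q)) (λ (p , q) → x#y′ (p , there q))
                   (trans (cong (map F) (∷ʳ-++ v c y)) eq₀) (trans (cong (map F) (∷ʳ-++ v c y′)) eq₀′))

  shift-reverse-blocks : ∀ {ν u v y y′} → length v ≡ ν → v ≢ [] → Disjoint u y → Disjoint u y′ →
    map F (v ++ y) ≡ y ++ u → map F (reverse v ++ y′) ≡ y′ ++ reverse u →
    ∃[ bs ] All (λ b → length b ≡ ν) bs × y ≡ concat bs × y′ ≡ concat (map reverse bs)
  shift-reverse-blocks {y = y} = go (<-wellFounded (length y))
    where
    ∈-map-reverse⁺ : ∀ {z} v → z ∈ map F v → z ∈ map F (reverse v)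
    ∈-map-reverse⁺ v z∈Fv = subst (_ ∈_) (sym (reverse-map F v)) (Any.reverse⁺ z∈Fv)

    ∈-map-reverse⁻ : ∀ {z} v → z ∈ map F (reverse v) → z ∈ map F v
    ∈-map-reverse⁻ v z∈Frv = Any.reverse⁻ (subst (_ ∈_) (reverse-map F v) z∈Frv)

    reversed-partial-blocks : ∀ v {y y′ d d′} → map F v ≡ y ++ d → map F (reverse v) ≡ y′ ++ d′ →
                              reverse d ++ reverse y ≡ y′ ++ d′
    reversed-partial-blocks v {y} {y′} {d} {d′} Fv≡y++d Frv≡y′++d′ = begin
      reverse d ++ reverse y ≡⟨ reverse-++ y d ⟨
      reverse (y ++ d)       ≡⟨ cong reverse Fv≡y++d ⟨
      reverse (map F v)      ≡⟨ reverse-map F v ⟨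
      map F (reverse v)      ≡⟨ Frv≡y′++d′ ⟩
      y′ ++ d′               ∎
      where open ≡-Reasoning

    go : ∀ {ν u v y y′} → Acc _<_ (length y) → length v ≡ ν → v ≢ [] → Disjoint u y → Disjoint u y′ →
      map F (v ++ y) ≡ y ++ u → map F (reverse v ++ y′) ≡ y′ ++ reverse u →
      ∃[ bs ] All (λ b → length b ≡ ν) bs × y ≡ concat bs × y′ ≡ concat (map reverse bs)
    go {u = u} {v} {y} {y′} (acc rec) |v|≡ν v≢[] u#y u#y′ eq eq′ with shift-step v y eq | shift-step (reverse v) y′ eq′
    ... | inj₁ (y₀ , refl , eq₀) | inj₁ (y₀′ , refl , eq₀′)
      with bs , |bs| , y₀≡ , y₀′≡ ← go (rec (length-++-<ʳ y₀ (map-≢[] F v≢[]))) (trans (length-map F v) |v|≡ν)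
             (map-≢[] F v≢[]) (λ (p , q) → u#y (p , ∈-++⁺ʳ _ q)) (λ (p , q) → u#y′ (p , ∈-++⁺ʳ _ q))
             eq₀ (subst (λ b → map F (b ++ y₀′) ≡ y₀′ ++ _) (reverse-map F v) eq₀′) =
      map F v ∷ bs , trans (length-map F v) |v|≡ν ∷ |bs| , cong (map F v ++_) y₀≡ ,
      cong₂ _++_ (reverse-map F v) y₀′≡
    ... | inj₁ (y₀ , refl , _) | inj₂ (d′ , d′≢[] , Frv≡y′++d′ , ru≡d′++Fy′) with z , z∈d′ ← nonempty-∈ d′≢[] =
      ⊥-elim (u#y ( Any.reverse⁻ (subst (_ ∈_) (sym ru≡d′++Fy′) (∈-++⁺ˡ z∈d′))
                  , ∈-++⁺ˡ (∈-map-reverse⁻ v (subst (_ ∈_) (sym Frv≡y′++d′) (∈-++⁺ʳ y′ z∈d′)))))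
    ... | inj₂ (d , d≢[] , Fv≡y++d , u≡d++Fy) | inj₁ (y₀′ , refl , _) with z , z∈d ← nonempty-∈ d≢[] =
      ⊥-elim (u#y′ ( subst (_ ∈_) (sym u≡d++Fy) (∈-++⁺ˡ z∈d)
                   , ∈-++⁺ˡ {ys = y₀′} (∈-map-reverse⁺ v (subst (_ ∈_) (sym Fv≡y++d) (∈-++⁺ʳ y z∈d)))))
    ... | inj₂ (d , d≢[] , Fv≡y++d , u≡d++Fy) | inj₂ (d′ , _ , Frv≡y′++d′ , ru≡d′++Fy′)
      with refl , refl ← partial-blocks-empty {u} {y} {y′} {d} {d′} d≢[]
             (λ z∈d → subst (_ ∈_) (sym u≡d++Fy) (∈-++⁺ˡ z∈d))
             (λ z∈d′ → Any.reverse⁻ (subst (_ ∈_) (sym ru≡d′++Fy′) (∈-++⁺ˡ z∈d′))) u#y u#y′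
             (reversed-partial-blocks v {y} {y′} {d} {d′} Fv≡y++d Frv≡y′++d′) =
      [] , [] , refl , refl

length-concat-blocks : ∀ {ν} (bs : List Word) → All (λ b → length b ≡ ν) bs → length (concat bs) ≡ length bs * ν
length-concat-blocks []       []           = refl
length-concat-blocks (b ∷ bs) (|b| ∷ |bs|) = trans (length-++ b) (cong₂ _+_ |b| (length-concat-blocks bs |bs|))

concat-blocks-injective : ∀ {ν} (bs cs : List Word) → All (λ b → length b ≡ ν) bs → All (λ c → length c ≡ ν) cs →
                          length bs ≡ length cs → concat bs ≡ concat cs → bs ≡ cs
concat-blocks-injective []       []       _            _            _   _  = refl
concat-blocks-injective (b ∷ bs) (c ∷ cs) (|b| ∷ |bs|) (|c| ∷ |cs|) len eq
  with refl , eq′ ← ++-cancel-length b (concat bs) c (concat cs) (trans |b| (sym |c|)) eq =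
  cong (b ∷_) (concat-blocks-injective bs cs |bs| |cs| (suc-injective len) eq′)

applyUpTo-+ : ∀ (f : ℕ → ℕ) m k → applyUpTo f (m + k) ≡ applyUpTo f m ++ applyUpTo (λ i → f (m + i)) k
applyUpTo-+ f zero    k = refl
applyUpTo-+ f (suc m) k = cong (f 0 ∷_) (applyUpTo-+ (λ i → f (suc i)) m k)

concat-xBlocks : ∀ ν h → concat (applyUpTo (xBlock ν) h) ≡ applyUpTo suc (h * ν)
concat-xBlocks ν zero    = refl
concat-xBlocks ν (suc h) = begin
  concat (applyUpTo (xBlock ν) (suc h))                  ≡⟨ cong concat (applyUpTo-∷ʳ (xBlock ν) h) ⟨
  concat (applyUpTo (xBlock ν) h ∷ʳ xBlock ν h)          ≡⟨ concat-++ (applyUpTo (xBlock ν) h) [ xBlock ν h ] ⟨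
  concat (applyUpTo (xBlock ν) h) ++ xBlock ν h ++ []    ≡⟨ cong₂ _++_ (concat-xBlocks ν h) (++-identityʳ (xBlock ν h)) ⟩
  applyUpTo suc (h * ν) ++ xBlock ν h                    ≡⟨ applyUpTo-+ suc (h * ν) ν ⟨
  applyUpTo suc (h * ν + ν)                              ≡⟨ cong (applyUpTo suc) (+-comm (h * ν) ν) ⟩
  applyUpTo suc (suc h * ν)                              ∎
  where open ≡-Reasoning

transpose : ℕ → ℕ → ℕ → ℕ
transpose i j k with k ≟ i
... | yes _ = j
... | no _ with k ≟ j
...   | yes _ = i
...   | no _  = k

transpose-i : ∀ i j → transpose i j i ≡ j
transpose-i i j with i ≟ i
... | yes _ = refl
... | no i≢i = ⊥-elim (i≢i refl)

transpose-j : ∀ i j → transpose i j j ≡ i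
transpose-j i j with j ≟ i
... | yes j≡i = j≡i
... | no _ with j ≟ j
...   | yes _  = refl
...   | no j≢j = ⊥-elim (j≢j refl)

transpose-other : ∀ {i j k} → k ≢ i → k ≢ j → transpose i j k ≡ k
transpose-other {i} {j} {k} k≢i k≢j with k ≟ i
... | yes k≡i = ⊥-elim (k≢i k≡i)
... | no _ with k ≟ j
...   | yes k≡j = ⊥-elim (k≢j k≡j)
...   | no _    = refl

transpose-involutive : ∀ i j k → transpose i j (transpose i j k) ≡ k
transpose-involutive i j k = by-cases (k ≟ i) (k ≟ j)
  where
  τ : ℕ → ℕ
  τ = transpose i j
  by-cases : Dec (k ≡ i) → Dec (k ≡ j) → τ (τ k) ≡ k
  by-cases (yes k≡i) _         = subst (λ m → τ (τ m) ≡ m) (sym k≡i) (trans (cong τ (transpose-i i j)) (transpose-j i j))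
  by-cases (no _)    (yes k≡j) = subst (λ m → τ (τ m) ≡ m) (sym k≡j) (trans (cong τ (transpose-j i j)) (transpose-i i j))
  by-cases (no k≢i)  (no k≢j)  = trans (cong τ (transpose-other k≢i k≢j)) (transpose-other k≢i k≢j)

transposition : ℕ → ℕ → ℕ ↔ ℕ
transposition i j = mk↔ₛ′ (transpose i j) (transpose i j) (transpose-involutive i j) (transpose-involutive i j)

↔-injective : (f : ℕ ↔ ℕ) → ∀ {a b} → Inverse.to f a ≡ Inverse.to f b → a ≡ b
↔-injective f {a} {b} eq =
  trans (sym (Inverse.strictlyInverseʳ f a)) (trans (cong (Inverse.from f) eq) (Inverse.strictlyInverseʳ f b))

unique-∼ : ∀ {p q : Word} → Unique p → Unique q → length p ≡ length q → p ∼ q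
unique-∼ {[]}    {[]}    _            _            _   = ↔-id ℕ , refl
unique-∼ {x ∷ p} {y ∷ q} (x∉p ∷ p-unique) (y∉q ∷ q-unique) len
  with f , fp≡q ← unique-∼ p-unique q-unique (suc-injective len) =
  transposition y (Inverse.to f x) ↔-∘ f , cong₂ _∷_ (transpose-j y (Inverse.to f x)) τfp≡q
  where
  open Inverse f using (to)
  τfp≡q : map (transpose y (to x) ∘ to) p ≡ q
  τfp≡q = begin
    map (transpose y (to x) ∘ to) p      ≡⟨ map-∘ p ⟩
    map (transpose y (to x)) (map to p)  ≡⟨ cong (map (transpose y (to x))) fp≡q ⟩
    map (transpose y (to x)) q           ≡⟨ map-id-local (All.tabulate fixed) ⟩
    q                                    ∎
    where
    open ≡-Reasoning
    fixed : ∀ {z} → z ∈ q → transpose y (to x) z ≡ z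
    fixed {z} z∈q with b , b∈p , refl ← ∈-map⁻ to (subst (_ ∈_) (sym fp≡q) z∈q) =
      transpose-other (λ z≡y → All.lookup y∉q z∈q (sym z≡y))
                      (λ tob≡tox → All.lookup x∉p b∈p (sym (↔-injective f tob≡tox)))

concat-xBlocks-unique : ∀ ν h → Unique (concat (applyUpTo (xBlock ν) h))
concat-xBlocks-unique ν h =
  subst Unique (sym (concat-xBlocks ν h)) (Unique.applyUpTo⁺₁ suc (h * ν) λ i<j _ eq → <⇒≢ i<j (suc-injective eq))

length-concat-xBlocks : ∀ ν h → length (concat (applyUpTo (xBlock ν) h)) ≡ h * ν
length-concat-xBlocks ν h = trans (cong length (concat-xBlocks ν h)) (length-applyUpTo suc (h * ν))

blocks-∼-Int : ∀ {ν} (bs : List Word) → All (λ b → length b ≡ ν) bs → Unique (concat bs) →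
               (concat bs ++ concat (map reverse bs)) ∼ Int (length bs) ν
blocks-∼-Int {ν} bs |bs| bs-unique
  with f , f-bs≡X ← unique-∼ bs-unique (concat-xBlocks-unique ν (length bs))
                      (trans (length-concat-blocks bs |bs|) (sym (length-concat-xBlocks ν (length bs)))) = f , (begin
  map g (concat bs ++ concat (map reverse bs))              ≡⟨ map-++ g (concat bs) _ ⟩
  map g (concat bs) ++ map g (concat (map reverse bs))      ≡⟨ cong₂ _++_ f-bs≡X (sym (concat-map (map reverse bs))) ⟩
  X ++ concat (map (map g) (map reverse bs))                ≡⟨ cong (λ cs → X ++ concat cs) map-reverse-blocks ⟩
  X ++ concat (map reverse (map (map g) bs))                ≡⟨ cong (λ cs → X ++ concat (map reverse cs)) g-blocks ⟩
  X ++ concat (map reverse (applyUpTo (xBlock ν) h))        ≡⟨ cong (λ cs → X ++ concat cs) (map-applyUpTo (xBlock ν) reverse h) ⟩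
  Int h ν                                                   ∎)
  where
  open ≡-Reasoning
  h = length bs
  X = concat (applyUpTo (xBlock ν) h)
  g = Inverse.to f
  map-reverse-blocks : map (map g) (map reverse bs) ≡ map reverse (map (map g) bs)
  map-reverse-blocks = trans (sym (map-∘ bs)) (trans (map-cong (reverse-map g) bs) (map-∘ bs))
  g-blocks : map (map g) bs ≡ applyUpTo (xBlock ν) h
  g-blocks = concat-blocks-injective (map (map g) bs) (applyUpTo (xBlock ν) h)
    (All.map⁺ (All.map (λ {b} |b| → trans (length-map g b) |b|) |bs|))
    (All.applyUpTo⁺₂ (xBlock ν) h (λ i → length-applyUpTo _ ν))
    (trans (length-map (map g) bs) (sym (length-applyUpTo (xBlock ν) h)))
    (trans (concat-map bs) f-bs≡X)

shift-return-∼-Int : ∀ {F : ℕ → ℕ} {ν m u y y′} → length u ≡ ν → u ≢ [] → length y ≡ m → 0 < m → Unique y →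
  Disjoint u y → Disjoint u y′ → map F (u ++ y) ≡ y ++ u → map F (reverse u ++ y′) ≡ y′ ++ reverse u →
  Σ ℕ (λ h → 1 ≤ h × m ≡ h * ν × (y ++ y′) ∼ Int h ν)
shift-return-∼-Int |u|≡ν u≢[] refl 0<|y| y-unique u#y u#y′ eq eq′
  with bs , |bs| , refl , refl ← shift-reverse-blocks |u|≡ν u≢[] u#y u#y′ eq eq′ =
  length bs , nonempty bs 0<|y| , length-concat-blocks bs |bs| , blocks-∼-Int bs |bs| y-unique
  where
  nonempty : ∀ (bs : List Word) → 0 < length (concat bs) → 1 ≤ length bs
  nonempty []      ()
  nonempty (_ ∷ _) _ = s≤s z≤n

0<length⇒≢[] : ∀ {xs : Word} → 0 < length xs → xs ≢ []
0<length⇒≢[] 0<|xs| refl with () ← 0<|xs|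

module FrontAndBackInsertion
  (w : Word) (ν : ℕ) (ν≥1 : 1 ≤ ν) (k ℓ : ℕ) (1<k : 1 < k) (k≤ℓ : k ≤ ℓ) (ℓ<n+1 : ℓ < suc (length w))
  (f : ℕ ↔ ℕ) (t₁ t₂ : InsType) (eq : map (Inverse.to f) (insert t₁ w ν 1 ℓ) ≡ insert t₂ w ν k (suc (length w)))
  where

  F : ℕ → ℕ
  F = Inverse.to f
  a b : ℕ
  a = k ∸ 1
  b = ℓ ∸ 1
  z₁ z₂ z₃ u c₁ c₂ : Word
  z₁ = take a w
  z₂ = drop a (take b w)
  z₃ = drop b w
  u  = newBlock (maxSym w) ν
  c₁ = closingBlock t₁ u
  c₂ = closingBlock t₂ u

  a≤b : a ≤ b
  a≤b = ∸-monoˡ-≤ 1 k≤ℓ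

  b<n : b < length w
  b<n = ∸-monoˡ-< ℓ<n+1 (≤-trans (<⇒≤ 1<k) k≤ℓ)

  w≡z₁z₂z₃ : w ≡ z₁ ++ z₂ ++ z₃
  w≡z₁z₂z₃ = trans (sym (take++drop≡id b w)) (trans (cong (_++ z₃) (take≡take++drop-take w a≤b)) (++-assoc z₁ z₂ z₃))

  equations : map F (u ++ z₁) ≡ z₁ ++ u × map F (c₁ ++ z₃) ≡ z₃ ++ c₂
  equations = insertion-equations F u z₁ z₂ z₃ c₁ c₂ (begin
    map F (u ++ (z₁ ++ z₂) ++ c₁ ++ z₃)   ≡⟨ cong (λ s → map F (u ++ s ++ c₁ ++ z₃)) (take≡take++drop-take w a≤b) ⟨
    map F (u ++ take b w ++ c₁ ++ z₃)     ≡⟨ cong (map F) (insert-closingBlock t₁ w ν 1 ℓ) ⟨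
    map F (insert t₁ w ν 1 ℓ)             ≡⟨ eq ⟩
    insert t₂ w ν k (suc (length w))      ≡⟨ insert-closingBlock t₂ w ν k (suc (length w)) ⟩
    z₁ ++ u ++ drop a (take (length w) w) ++ c₂ ++ drop (length w) w
      ≡⟨ cong₂ (λ s s′ → z₁ ++ u ++ drop a s ++ c₂ ++ s′) (take-all (length w) w ≤-refl) (drop-all (length w) w ≤-refl) ⟩
    z₁ ++ u ++ drop a w ++ c₂ ++ []       ≡⟨ cong₂ (λ s s′ → z₁ ++ u ++ s ++ s′) (drop≡drop-take++drop w a≤b) (++-identityʳ c₂) ⟩
    z₁ ++ u ++ (z₂ ++ z₃) ++ c₂           ∎)
    where open ≡-Reasoning

  F-injective : ∀ {x y} → F x ≡ F y → x ≡ y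
  F-injective = ↔-injective f

  |z₁|≡a : length z₁ ≡ a
  |z₁|≡a = trans (length-take a w) (m≤n⇒m⊓n≡m (≤-trans a≤b (<⇒≤ b<n)))

  |u|≡ν : length u ≡ ν
  |u|≡ν = length-applyUpTo _ ν

  u≢[] : u ≢ []
  u≢[] = 0<length⇒≢[] (subst (0 <_) (sym |u|≡ν) ν≥1)

  u#z₁ : Disjoint u z₁
  u#z₁ (x∈u , x∈z₁) = newBlock-fresh w ν (x∈u , subst (_ ∈_) (sym w≡z₁z₂z₃) (∈-++⁺ˡ x∈z₁))

  u#z₃ : Disjoint u z₃
  u#z₃ (x∈u , x∈z₃) = newBlock-fresh w ν (x∈u , subst (_ ∈_) (sym w≡z₁z₂z₃) (∈-++⁺ʳ z₁ (∈-++⁺ʳ z₂ x∈z₃)))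

  c₁↭u : c₁ ↭ u
  c₁↭u = closingBlock-↭ t₁ u

  z₁-sow : SOW z₁
  z₁-sow = 0<length⇒≢[] (subst (0 <_) (sym |z₁|≡a) (∸-monoˡ-≤ 1 1<k)) ,
           shift⇒Unique F-injective u≢[] (newBlock-unique (maxSym w) ν) u#z₁ (proj₁ equations)

  z₃-sow : SOW z₃
  z₃-sow = 0<length⇒≢[] (subst (0 <_) (sym (length-drop b w)) (m<n⇒0<n∸m b<n)) ,
           shift⇒Unique F-injective c₁≢[] (Unique-resp-↭ (↭-sym c₁↭u) (newBlock-unique (maxSym w) ν))
             (λ (x∈c₁ , x∈z₃) → u#z₃ (∈-resp-↭ c₁↭u x∈c₁ , x∈z₃)) (proj₂ equations)
    where
    c₁≢[] : c₁ ≢ []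
    c₁≢[] = 0<length⇒≢[] (subst (0 <_) (sym (trans (xs↭ys⇒|xs|≡|ys| c₁↭u) |u|≡ν)) ν≥1)

  z₁z₃-repeat : t₁ ≡ repeatIns → t₂ ≡ repeatIns → RepeatWordIn (z₁ ++ z₃) w
  z₁z₃-repeat refl refl = z₁ , z₁-sow , cong (z₁ ++_) (sym z₁≡z₃) , [] , z₂ , [] ,
    trans w≡z₁z₂z₃ (cong (λ s → z₁ ++ z₂ ++ s) (trans (sym z₁≡z₃) (sym (++-identityʳ z₁))))
    where
    z₁≡z₃ : z₁ ≡ z₃
    z₁≡z₃ = shift-determined u u≢[] u#z₁ u#z₃ (proj₁ equations) (proj₂ equations)

  z₁z₃-∼-Int : t₁ ≡ returnIns → t₂ ≡ returnIns → Σ ℕ (λ h → 1 ≤ h × a ≡ h * ν × (z₁ ++ z₃) ∼ Int h ν)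
  z₁z₃-∼-Int refl refl = shift-return-∼-Int |u|≡ν u≢[] |z₁|≡a (∸-monoˡ-≤ 1 1<k) (proj₂ z₁-sow) u#z₁ u#z₃
                           (proj₁ equations) (proj₂ equations)

proposition3p1 : (w : Word) (n ν k₁ ℓ₁ k₂ ℓ₂ : ℕ) (t₁ t₂ : InsType) →
    DOW w → Ascending w → length w ≡ n → 1 ≤ ν →
    insert t₁ w ν k₁ ℓ₁ ∼ insert t₂ w ν k₂ ℓ₂ →
    k₁ ≡ 1 → ℓ₂ ≡ suc n → k₁ < k₂ → k₂ ≤ ℓ₁ → ℓ₁ < ℓ₂ →
    let z₁ = take (k₂ ∸ 1) w
        z₂ = drop (k₂ ∸ 1) (take (ℓ₁ ∸ 1) w)
        z₃ = drop (ℓ₁ ∸ 1) w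
    in SOW z₁ × SOW z₃
       × (t₁ ≡ repeatIns → t₂ ≡ repeatIns → RepeatWordIn (z₁ ++ z₃) w)
       × (t₁ ≡ returnIns → t₂ ≡ returnIns →
           Σ ℕ (λ h → 1 ≤ h × k₂ ∸ k₁ ≡ h * ν × (z₁ ++ z₃) ∼ Int h ν))
proposition3p1 w _ ν _ ℓ₁ k₂ _ t₁ t₂ _ _ refl ν≥1 (f , eq) refl refl 1<k₂ k₂≤ℓ₁ ℓ₁<ℓ₂ =
  z₁-sow , z₃-sow , z₁z₃-repeat , z₁z₃-∼-Int
  where open FrontAndBackInsertion w ν ν≥1 k₂ ℓ₁ 1<k₂ k₂≤ℓ₁ ℓ₁<ℓ₂ f t₁ t₂ eq
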